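{- Let $\mathcal{C}$ be a category with finite products and weak pullbacks. The class of split epimorphisms of $\mathcal{C}$ is a system of covers, and it is contained in every system of covers on $\mathcal{C}$.
   Context: Composition is diagrammatic ($f;g$ means first $f$ then $g$); $\pi\colon A\to B$ is a split epimorphism if there is $f\colon B\to A$ with $f;\pi=\mathrm{id}_B$. A weak pullback is a commutative square satisfying the existence (not necessarily uniqueness) part of the pullback universal property. A system of covers on $\mathcal{C}$ is a class $\mathcal{S}$ of morphisms that contains identities, is closed under composition and products, is closed under weak pullback (in any weak pullback square of $\pi\in\mathcal{S}$ along a morphism, the leg opposite $\pi$ is in $\mathcal{S}$), and satisfies: $f;\pi\in\mathcal{S}$ implies $\pi\in\mathcal{S}$. -}

module Defs where

open import Level using (Level; _⊔_; suc)
open import Data.Product using (Σ; _×_; _,_; ∃-syntax)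
open import Relation.Binary using (IsEquivalence)

-- A (locally small, setoid-enriched) category, composition diagrammatic: f ⨾ g = first f then g.
record Category (o ℓ e : Level) : Set (suc (o ⊔ ℓ ⊔ e)) where
  infixr 9 _⨾_
  infix 4 _≈_
  field
    Obj : Set o
    Hom : Obj → Obj → Set ℓ
    _≈_ : ∀ {A B} → Hom A B → Hom A B → Set e
    id  : ∀ {A} → Hom A A
    _⨾_ : ∀ {A B C} → Hom A B → Hom B C → Hom A C
    ≈-equiv : ∀ {A B} → IsEquivalence (_≈_ {A} {B})
    assoc : ∀ {A B C D} (f : Hom A B) (g : Hom B C) (h : Hom C D) →
            (f ⨾ g) ⨾ h ≈ f ⨾ (g ⨾ h)
    idˡ : ∀ {A B} (f : Hom A B) → id ⨾ f ≈ f
    idʳ : ∀ {A B} (f : Hom A B) → f ⨾ id ≈ f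
    ⨾-resp-≈ : ∀ {A B C} {f f′ : Hom A B} {g g′ : Hom B C} →
               f ≈ f′ → g ≈ g′ → f ⨾ g ≈ f′ ⨾ g′

record FiniteProducts {o ℓ e} (𝒞 : Category o ℓ e) : Set (o ⊔ ℓ ⊔ e) where
  open Category 𝒞
  field
    ⊤ : Obj
    ! : ∀ {A} → Hom A ⊤
    !-unique : ∀ {A} (f : Hom A ⊤) → f ≈ !
    _⊗_ : Obj → Obj → Obj
    π₁ : ∀ {A B} → Hom (A ⊗ B) A
    π₂ : ∀ {A B} → Hom (A ⊗ B) B
    ⟨_,_⟩ : ∀ {X A B} → Hom X A → Hom X B → Hom X (A ⊗ B)
    ⟨⟩-π₁ : ∀ {X A B} (f : Hom X A) (g : Hom X B) → ⟨ f , g ⟩ ⨾ π₁ ≈ f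
    ⟨⟩-π₂ : ∀ {X A B} (f : Hom X A) (g : Hom X B) → ⟨ f , g ⟩ ⨾ π₂ ≈ g
    ⟨⟩-unique : ∀ {X A B} (f : Hom X A) (g : Hom X B) (h : Hom X (A ⊗ B)) →
                h ⨾ π₁ ≈ f → h ⨾ π₂ ≈ g → h ≈ ⟨ f , g ⟩

  _⊗₁_ : ∀ {A B C D} → Hom A B → Hom C D → Hom (A ⊗ C) (B ⊗ D)
  f ⊗₁ g = ⟨ π₁ ⨾ f , π₂ ⨾ g ⟩

module _ {o ℓ e} (𝒞 : Category o ℓ e) where
  open Category 𝒞

  IsWeakPullback : ∀ {P A B C} → Hom P A → Hom P B → Hom A C → Hom B C → Set (o ⊔ ℓ ⊔ e)
  IsWeakPullback {P} {A} {B} p₁ p₂ f g =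
    (p₁ ⨾ f ≈ p₂ ⨾ g) ×
    (∀ {Q} (q₁ : Hom Q A) (q₂ : Hom Q B) → q₁ ⨾ f ≈ q₂ ⨾ g →
       ∃[ u ] ((u ⨾ p₁ ≈ q₁) × (u ⨾ p₂ ≈ q₂)))

  HasWeakPullbacks : Set (o ⊔ ℓ ⊔ e)
  HasWeakPullbacks = ∀ {A B C} (f : Hom A C) (g : Hom B C) →
    ∃[ P ] Σ (Hom P A) λ p₁ → Σ (Hom P B) λ p₂ → IsWeakPullback p₁ p₂ f g

  MorClass : (r : Level) → Set (o ⊔ ℓ ⊔ suc r)
  MorClass r = ∀ {A B} → Hom A B → Set r

  Respects≈ : ∀ {r} → MorClass r → Set (o ⊔ ℓ ⊔ e ⊔ r)
  Respects≈ S = ∀ {A B} {f g : Hom A B} → f ≈ g → S f → S g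

  SplitEpi : ∀ {A B} → Hom A B → Set (ℓ ⊔ e)
  SplitEpi {A} {B} π = Σ (Hom B A) λ f → f ⨾ π ≈ id

  _⊆_ : ∀ {r s} → MorClass r → MorClass s → Set (o ⊔ ℓ ⊔ r ⊔ s)
  S ⊆ T = ∀ {A B} (f : Hom A B) → S f → T f

  record IsSystemOfCovers {r} (P : FiniteProducts 𝒞) (S : MorClass r)
         : Set (o ⊔ ℓ ⊔ e ⊔ r) where
    open FiniteProducts P
    field
      resp-≈   : Respects≈ S
      id-∈     : ∀ {A} → S (id {A})
      ⨾-∈      : ∀ {A B C} {f : Hom A B} {g : Hom B C} → S f → S g → S (f ⨾ g)
      ⊗-∈      : ∀ {A B C D} {f : Hom A B} {g : Hom C D} → S f → S g → S (f ⊗₁ g)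
      pullback-∈ : ∀ {P A B C} {π : Hom A C} {g : Hom B C}
                   {p₁ : Hom P A} {p₂ : Hom P B} →
                   S π → IsWeakPullback p₁ p₂ π g → S p₂
      cancel-∈ : ∀ {A B C} {f : Hom A B} {π : Hom B C} → S (f ⨾ π) → S π

module Submission where

open import Defs
open import Level using (Level)
open import Data.Product using (_×_; _,_)
open import Relation.Binary.Bundles using (Setoid)
open import Relation.Binary.Structures using (IsEquivalence)
import Relation.Binary.Reasoning.Setoid as SetoidReasoning

module SplitEpimorphisms {o ℓ e} (𝒞 : Category o ℓ e) where
  open Category 𝒞

  module ≈ {A B} = IsEquivalence (≈-equiv {A} {B})

  hom-setoid : ∀ {A B} → Setoid ℓ e
  hom-setoid {A} {B} = record { isEquivalence = ≈-equiv {A} {B} }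

  module HomReasoning {A B} = SetoidReasoning (hom-setoid {A} {B})
  open HomReasoning

  cancelʳ : ∀ {X A B} (h : Hom X A) {s : Hom A B} {π : Hom B A} →
            s ⨾ π ≈ id → (h ⨾ s) ⨾ π ≈ h
  cancelʳ h {s} {π} sπ≈id = begin
    (h ⨾ s) ⨾ π  ≈⟨ assoc h s π ⟩
    h ⨾ (s ⨾ π)  ≈⟨ ⨾-resp-≈ ≈.refl sπ≈id ⟩
    h ⨾ id       ≈⟨ idʳ h ⟩
    h            ∎

  glue : ∀ {W X Y Z U V} {a : Hom W X} {b : Hom X Y} {r : Hom Y Z}
         {p : Hom W U} {q : Hom X V} {u : Hom U V} {v : Hom V Z} →
         a ⨾ q ≈ p ⨾ u → b ⨾ r ≈ q ⨾ v → (a ⨾ b) ⨾ r ≈ p ⨾ (u ⨾ v)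
  glue {a = a} {b} {r} {p} {q} {u} {v} aq≈pu br≈qv = begin
    (a ⨾ b) ⨾ r  ≈⟨ assoc a b r ⟩
    a ⨾ (b ⨾ r)  ≈⟨ ⨾-resp-≈ ≈.refl br≈qv ⟩
    a ⨾ (q ⨾ v)  ≈⟨ ≈.sym (assoc a q v) ⟩
    (a ⨾ q) ⨾ v  ≈⟨ ⨾-resp-≈ aq≈pu ≈.refl ⟩
    (p ⨾ u) ⨾ v  ≈⟨ assoc p u v ⟩
    p ⨾ (u ⨾ v)  ∎

  splitEpi-resp-≈ : Respects≈ 𝒞 (SplitEpi 𝒞)
  splitEpi-resp-≈ π≈π′ (s , sπ≈id) = s , ≈.trans (⨾-resp-≈ ≈.refl (≈.sym π≈π′)) sπ≈id

  id-splitEpi : ∀ {A} → SplitEpi 𝒞 (id {A})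
  id-splitEpi = id , idˡ id

  splitEpi-⨾ : ∀ {A B C} {f : Hom A B} {g : Hom B C} →
               SplitEpi 𝒞 f → SplitEpi 𝒞 g → SplitEpi 𝒞 (f ⨾ g)
  splitEpi-⨾ {f = f} {g} (s , sf≈id) (t , tg≈id) = t ⨾ s , (begin
    (t ⨾ s) ⨾ (f ⨾ g)  ≈⟨ ≈.sym (assoc (t ⨾ s) f g) ⟩
    ((t ⨾ s) ⨾ f) ⨾ g  ≈⟨ ⨾-resp-≈ (cancelʳ t sf≈id) ≈.refl ⟩
    t ⨾ g              ≈⟨ tg≈id ⟩
    id                 ∎)

  splitEpi-cancelˡ : ∀ {A B C} {f : Hom A B} {π : Hom B C} →
                     SplitEpi 𝒞 (f ⨾ π) → SplitEpi 𝒞 π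
  splitEpi-cancelˡ {f = f} {π} (s , s⨾fπ≈id) = s ⨾ f , ≈.trans (assoc s f π) s⨾fπ≈id

  -- The section s of π gives the cone (g ⨾ s , id) over π and g; its mediating
  -- morphism is a section of p₂.
  splitEpi-weakPullback : ∀ {Q A B C} {π : Hom A C} {g : Hom B C}
                          {p₁ : Hom Q A} {p₂ : Hom Q B} →
                          SplitEpi 𝒞 π → IsWeakPullback 𝒞 p₁ p₂ π g → SplitEpi 𝒞 p₂
  splitEpi-weakPullback {g = g} (s , sπ≈id) (_ , factor)
    with factor (g ⨾ s) id (≈.trans (cancelʳ g sπ≈id) (≈.sym (idˡ g)))
  ... | u , _ , up₂≈id = u , up₂≈id

  splitEpi⊆ : ∀ {r} (S : MorClass 𝒞 r) → Respects≈ 𝒞 S → (∀ {A} → S (id {A})) →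
              (∀ {A B C} {f : Hom A B} {π : Hom B C} → S (f ⨾ π) → S π) →
              _⊆_ 𝒞 (SplitEpi 𝒞) S
  splitEpi⊆ S resp id-∈ cancel-∈ π (s , sπ≈id) = cancel-∈ (resp (≈.sym sπ≈id) id-∈)

  module WithProducts (P : FiniteProducts 𝒞) where
    open FiniteProducts P

    ⟨⟩-cong : ∀ {X A B} {f f′ : Hom X A} {g g′ : Hom X B} →
              f ≈ f′ → g ≈ g′ → ⟨ f , g ⟩ ≈ ⟨ f′ , g′ ⟩
    ⟨⟩-cong f≈f′ g≈g′ = ⟨⟩-unique _ _ _
      (≈.trans (⟨⟩-π₁ _ _) f≈f′) (≈.trans (⟨⟩-π₂ _ _) g≈g′)

    ⊗₁-id : ∀ {A B} → id {A} ⊗₁ id {B} ≈ id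
    ⊗₁-id = ≈.sym (⟨⟩-unique _ _ id
      (≈.trans (idˡ π₁) (≈.sym (idʳ π₁))) (≈.trans (idˡ π₂) (≈.sym (idʳ π₂))))

    ⊗₁-⨾ : ∀ {A B C D E F} (f : Hom A B) (g : Hom C D) (h : Hom B E) (k : Hom D F) →
           (f ⊗₁ g) ⨾ (h ⊗₁ k) ≈ (f ⨾ h) ⊗₁ (g ⨾ k)
    ⊗₁-⨾ f g h k = ⟨⟩-unique _ _ _ (glue (⟨⟩-π₁ _ _) (⟨⟩-π₁ _ _))
                                    (glue (⟨⟩-π₂ _ _) (⟨⟩-π₂ _ _))

    splitEpi-⊗₁ : ∀ {A B C D} {f : Hom A B} {g : Hom C D} →
                  SplitEpi 𝒞 f → SplitEpi 𝒞 g → SplitEpi 𝒞 (f ⊗₁ g)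
    splitEpi-⊗₁ {f = f} {g} (s , sf≈id) (t , tg≈id) = s ⊗₁ t , (begin
      (s ⊗₁ t) ⨾ (f ⊗₁ g)  ≈⟨ ⊗₁-⨾ s t f g ⟩
      (s ⨾ f) ⊗₁ (t ⨾ g)   ≈⟨ ⟨⟩-cong (⨾-resp-≈ ≈.refl sf≈id) (⨾-resp-≈ ≈.refl tg≈id) ⟩
      id ⊗₁ id             ≈⟨ ⊗₁-id ⟩
      id                   ∎)

    splitEpi-isSystemOfCovers : IsSystemOfCovers 𝒞 P (SplitEpi 𝒞)
    splitEpi-isSystemOfCovers = record
      { resp-≈     = splitEpi-resp-≈
      ; id-∈       = id-splitEpi
      ; ⨾-∈        = splitEpi-⨾
      ; ⊗-∈        = splitEpi-⊗₁
      ; pullback-∈ = splitEpi-weakPullback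
      ; cancel-∈   = splitEpi-cancelˡ
      }

    splitEpi⊆systemOfCovers : ∀ {r} (S : MorClass 𝒞 r) → IsSystemOfCovers 𝒞 P S →
                              _⊆_ 𝒞 (SplitEpi 𝒞) S
    splitEpi⊆systemOfCovers S isCovers = splitEpi⊆ S resp-≈ id-∈ cancel-∈
      where open IsSystemOfCovers isCovers

lemma7p7 : ∀ {o ℓ e} (r : Level) (𝒞 : Category o ℓ e) (P : FiniteProducts 𝒞) →
           HasWeakPullbacks 𝒞 →
           IsSystemOfCovers 𝒞 P (SplitEpi 𝒞) ×
           ((S : MorClass 𝒞 r) → IsSystemOfCovers 𝒞 P S → _⊆_ 𝒞 (SplitEpi 𝒞) S)
lemma7p7 r 𝒞 P _ = splitEpi-isSystemOfCovers , splitEpi⊆systemOfCovers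
  where open SplitEpimorphisms.WithProducts 𝒞 P
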